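{- Let $a,b$ be integers with $b\ge 1$ and $b\le a\le 2b$. Then there is a graph $G$ with $n$ vertices and $m$ edges such that $\frac{m}{n}=\frac{a}{b}$ and $\psi_3(G)\ge \frac{2n+m}{6}$.
   Context: Graphs are finite and simple. A subset $S\subseteq V(G)$ is a $3$-path vertex cover of $G$ if every path on $3$ vertices in $G$ contains at least one vertex of $S$; $\psi_3(G)$ denotes the minimum cardinality of a $3$-path vertex cover of $G$. -}

module Defs where

open import Data.Nat using (ℕ; zero; suc; _+_; _*_; _<ᵇ_)
open import Data.Bool using (Bool; true; false; _∧_)
open import Data.Fin using (Fin; toℕ)
open import Data.Fin.Subset using (Subset; _∈_; ∣_∣)
open import Data.List using (List; []; _∷_; map; concatMap; allFin)
open import Data.Sum using (_⊎_)
open import Relation.Binary.PropositionalEquality using (_≡_; _≢_)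

record Graph (n : ℕ) : Set where
  field
    adj    : Fin n → Fin n → Bool
    sym    : ∀ i j → adj i j ≡ adj j i
    irrefl : ∀ i → adj i i ≡ false

open Graph public

countTrue : List Bool → ℕ
countTrue [] = 0
countTrue (true ∷ bs) = suc (countTrue bs)
countTrue (false ∷ bs) = countTrue bs

edgeCount : ∀ {n} → Graph n → ℕ
edgeCount {n} G =
  countTrue (concatMap (λ i → map (λ j → (toℕ i <ᵇ toℕ j) ∧ adj G i j) (allFin n)) (allFin n))

-- S is a 3-path vertex cover: every path u - v - w on 3 (distinct) vertices
-- contains a vertex of S.  (u ≢ v and v ≢ w follow from irreflexivity.)
Is3PVC : ∀ {n} → Graph n → Subset n → Set
Is3PVC {n} G S =
  ∀ (u v w : Fin n) → u ≢ w → adj G u v ≡ true → adj G v w ≡ true →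
  (u ∈ S) ⊎ (v ∈ S) ⊎ (w ∈ S)

-- ψ₃(G) ≥ r (r rational p/q, q ≥ 1, encoded as  q·ψ₃(G) ≥ p):
-- every 3-path vertex cover S satisfies q·|S| ≥ p, i.e. the minimum
-- cardinality of a 3-path vertex cover is at least p/q.
ψ₃≥ : ∀ {n} → Graph n → (p q : ℕ) → Set
ψ₃≥ {n} G p q = ∀ (S : Subset n) → Is3PVC G S → p Data.Nat.≤ q * ∣ S ∣

-- In a complete multipartite graph whose parts have at most two vertices, any three vertices
-- span a path on three vertices, so a 3-path vertex cover misses at most two vertices:
-- ψ₃ ≥ n − 2.  Hence C₄ = K₂,₂ (n = 4, m = 4, ψ₃ = 2) and the octahedron K₂,₂,₂ (n = 6,
-- m = 12, ψ₃ = 4) both satisfy 6ψ₃ = 2n + m.  Vertices, edges and ψ₃ add up over disjoint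
-- unions, so 3c copies of C₄ and 2d copies of the octahedron have n = 12(c + d),
-- m = 12(c + 2d) and 6ψ₃ = 2n + m; taking d = a − b and c = 2b − a gives m/n = a/b.
module Submission where

open import Defs
open import Data.Nat using (ℕ; zero; suc; _+_; _*_; _∸_; _≤_; _<ᵇ_; z≤n; s≤s⁻¹; _≤?_)
open import Data.Nat.Properties
  using (+-0-monoid; +-assoc; +-identityʳ; +-suc; +-mono-≤; +-cancelˡ-≤; *-monoʳ-≤; m≤n*m;
         ≤-trans; ≤-reflexive; ≰⇒>; m+[n∸m]≡n; m∸n+n≡m; m≤n+o⇒m∸n≤o)
open import Algebra.Properties.Monoid.Sum +-0-monoid using (sum-syntax; sum-cong-≗; sum-replicate-zero)
open import Data.Nat.Tactic.RingSolver using (solve-∀)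
open import Data.Bool using (Bool; true; false; _∧_; not)
open import Data.Bool.Properties using (∧-zeroʳ)
open import Data.Fin using (Fin; zero; suc; toℕ; _↑ˡ_; _↑ʳ_; splitAt; quotient; remainder; combine; _≟_)
open import Data.Fin.Properties
  using (toℕ-↑ˡ; toℕ-↑ʳ; splitAt-↑ˡ; splitAt-↑ʳ; ↑ˡ-injective; ↑ʳ-injective; suc-injective; combine-remQuot)
open import Data.Fin.Subset using (Subset; inside; outside; _∈_; _∉_; ∣_∣)
open import Data.Vec using ([]; _∷_; _++_; here; there)
import Data.Vec as Vec
open import Data.List using (List; []; _∷_; map; concat; tabulate; allFin)
import Data.List as List
open import Data.List.Properties using (map-tabulate)
open import Data.Product using (Σ; Σ-syntax; ∃₂; _×_; _,_)
open import Data.Sum using (_⊎_; inj₁; inj₂; [_,_]′; map₂; swap)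
import Data.Sum as Sum
open import Function using (_∘_; id)
open import Function.Bundles using (mk⇔)
open import Function.Definitions using (Injective)
open import Relation.Nullary using (yes; no; contradiction)
open import Relation.Nullary.Decidable using (does; dec-true; dec-false; does-⇔)
open import Relation.Binary.PropositionalEquality using (_≡_; _≢_; refl; trans; cong; cong₂; subst)
import Relation.Binary.PropositionalEquality as ≡
open ≡.≡-Reasoning

indicator : Bool → ℕ
indicator true  = 1
indicator false = 0

countTrue-∷ : ∀ b bs → countTrue (b ∷ bs) ≡ indicator b + countTrue bs
countTrue-∷ true  bs = refl
countTrue-∷ false bs = refl

countTrue-++ : ∀ bs cs → countTrue (bs List.++ cs) ≡ countTrue bs + countTrue cs
countTrue-++ []           cs = refl
countTrue-++ (true ∷ bs)  cs = cong suc (countTrue-++ bs cs)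
countTrue-++ (false ∷ bs) cs = countTrue-++ bs cs

countTrue-tabulate : ∀ {n} (b : Fin n → Bool) → countTrue (tabulate b) ≡ ∑[ i < n ] indicator (b i)
countTrue-tabulate {zero}  b = refl
countTrue-tabulate {suc n} b =
  trans (countTrue-∷ (b zero) _) (cong (indicator (b zero) +_) (countTrue-tabulate (b ∘ suc)))

countTrue-concat-tabulate : ∀ {n} (r : Fin n → List Bool) →
  countTrue (concat (tabulate r)) ≡ ∑[ i < n ] countTrue (r i)
countTrue-concat-tabulate {zero}  r = refl
countTrue-concat-tabulate {suc n} r =
  trans (countTrue-++ (r zero) _) (cong (countTrue (r zero) +_) (countTrue-concat-tabulate (r ∘ suc)))

sum-↑ : ∀ m {n} (f : Fin (m + n) → ℕ) →
  ∑[ i < m + n ] f i ≡ ∑[ i < m ] f (i ↑ˡ n) + ∑[ j < n ] f (m ↑ʳ j)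
sum-↑ zero    f = refl
sum-↑ (suc m) f = trans (cong (f zero +_) (sum-↑ m (f ∘ suc))) (≡.sym (+-assoc (f zero) _ _))

<ᵇ-cancelˡ-+ : ∀ k x y → (k + x <ᵇ k + y) ≡ (x <ᵇ y)
<ᵇ-cancelˡ-+ zero    x y = refl
<ᵇ-cancelˡ-+ (suc k) x y = <ᵇ-cancelˡ-+ k x y

isEdge : ∀ {n} → Graph n → Fin n → Fin n → Bool
isEdge G i j = (toℕ i <ᵇ toℕ j) ∧ adj G i j

edgeCount-sum : ∀ {n} (G : Graph n) → edgeCount G ≡ ∑[ i < n ] ∑[ j < n ] indicator (isEdge G i j)
edgeCount-sum {n} G = begin
  countTrue (concat (map row (allFin n))) ≡⟨ cong (countTrue ∘ concat) (map-tabulate id row) ⟩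
  countTrue (concat (tabulate row))       ≡⟨ countTrue-concat-tabulate row ⟩
  ∑[ i < n ] countTrue (row i)            ≡⟨ sum-cong-≗ countTrue-row ⟩
  ∑[ i < n ] ∑[ j < n ] indicator (isEdge G i j) ∎
  where
  row : Fin n → List Bool
  row i = map (isEdge G i) (allFin n)
  countTrue-row : ∀ i → countTrue (row i) ≡ ∑[ j < n ] indicator (isEdge G i j)
  countTrue-row i =
    trans (cong countTrue (map-tabulate id (isEdge G i))) (countTrue-tabulate (isEdge G i))

infix 4 _≤ψ₃_
_≤ψ₃_ : ∀ {n} → ℕ → Graph n → Set
_≤ψ₃_ {n} k G = ∀ (S : Subset n) → Is3PVC G S → k ≤ ∣ S ∣

≤ψ₃⇒ψ₃≥ : ∀ {n} {G : Graph n} {k p} q → p ≤ q * k → k ≤ψ₃ G → ψ₃≥ G p q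
≤ψ₃⇒ψ₃≥ q p≤q*k k≤ψ₃G S S-covers = ≤-trans p≤q*k (*-monoʳ-≤ q (k≤ψ₃G S S-covers))

∣p++q∣≡∣p∣+∣q∣ : ∀ {n m} (p : Subset n) (q : Subset m) → ∣ p ++ q ∣ ≡ ∣ p ∣ + ∣ q ∣
∣p++q∣≡∣p∣+∣q∣ []            q = refl
∣p++q∣≡∣p∣+∣q∣ (inside ∷ p)  q = cong suc (∣p++q∣≡∣p∣+∣q∣ p q)
∣p++q∣≡∣p∣+∣q∣ (outside ∷ p) q = ∣p++q∣≡∣p∣+∣q∣ p q

x↑ˡ∈p++q⇒x∈p : ∀ {n m} (p : Subset n) {q : Subset m} {x} → x ↑ˡ m ∈ p ++ q → x ∈ p
x↑ˡ∈p++q⇒x∈p (_ ∷ p) {x = zero}  here      = here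
x↑ˡ∈p++q⇒x∈p (_ ∷ p) {x = suc x} (there e) = there (x↑ˡ∈p++q⇒x∈p p e)

n↑ʳx∈p++q⇒x∈q : ∀ {n m} (p : Subset n) {q : Subset m} {x} → n ↑ʳ x ∈ p ++ q → x ∈ q
n↑ʳx∈p++q⇒x∈q []      e         = e
n↑ʳx∈p++q⇒x∈q (_ ∷ p) (there e) = n↑ʳx∈p++q⇒x∈q p e

module _ {n m : ℕ} (G : Graph n) (H : Graph m) where

  private
    adj⊎ : Fin n ⊎ Fin m → Fin n ⊎ Fin m → Bool
    adj⊎ (inj₁ u) (inj₁ v) = adj G u v
    adj⊎ (inj₂ u) (inj₂ v) = adj H u v
    adj⊎ (inj₁ u) (inj₂ v) = false
    adj⊎ (inj₂ u) (inj₁ v) = false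

    adj⊎-sym : ∀ x y → adj⊎ x y ≡ adj⊎ y x
    adj⊎-sym (inj₁ u) (inj₁ v) = Graph.sym G u v
    adj⊎-sym (inj₂ u) (inj₂ v) = Graph.sym H u v
    adj⊎-sym (inj₁ u) (inj₂ v) = refl
    adj⊎-sym (inj₂ u) (inj₁ v) = refl

    adj⊎-irrefl : ∀ x → adj⊎ x x ≡ false
    adj⊎-irrefl (inj₁ u) = irrefl G u
    adj⊎-irrefl (inj₂ u) = irrefl H u

  infixr 6 _⊕_
  _⊕_ : Graph (n + m)
  _⊕_ = record
    { adj    = λ i j → adj⊎ (splitAt n i) (splitAt n j)
    ; sym    = λ i j → adj⊎-sym (splitAt n i) (splitAt n j)
    ; irrefl = λ i → adj⊎-irrefl (splitAt n i)
    }

  ⊕-adj-↑ˡ↑ˡ : ∀ u v → adj _⊕_ (u ↑ˡ m) (v ↑ˡ m) ≡ adj G u v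
  ⊕-adj-↑ˡ↑ˡ u v rewrite splitAt-↑ˡ n u m | splitAt-↑ˡ n v m = refl

  ⊕-adj-↑ʳ↑ʳ : ∀ u v → adj _⊕_ (n ↑ʳ u) (n ↑ʳ v) ≡ adj H u v
  ⊕-adj-↑ʳ↑ʳ u v rewrite splitAt-↑ʳ n m u | splitAt-↑ʳ n m v = refl

  ⊕-adj-↑ˡ↑ʳ : ∀ u v → adj _⊕_ (u ↑ˡ m) (n ↑ʳ v) ≡ false
  ⊕-adj-↑ˡ↑ʳ u v rewrite splitAt-↑ˡ n u m | splitAt-↑ʳ n m v = refl

  ⊕-adj-↑ʳ↑ˡ : ∀ u v → adj _⊕_ (n ↑ʳ u) (v ↑ˡ m) ≡ false
  ⊕-adj-↑ʳ↑ˡ u v rewrite splitAt-↑ʳ n m u | splitAt-↑ˡ n v m = refl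

  private
    edge : Fin (n + m) → Fin (n + m) → ℕ
    edge i j = indicator (isEdge _⊕_ i j)

    edgeCountˡ : ∀ u → ∑[ j < n + m ] edge (u ↑ˡ m) j ≡ ∑[ v < n ] indicator (isEdge G u v)
    edgeCountˡ u = begin
      ∑[ j < n + m ] edge (u ↑ˡ m) j
        ≡⟨ sum-↑ n _ ⟩
      ∑[ v < n ] edge (u ↑ˡ m) (v ↑ˡ m) + ∑[ v < m ] edge (u ↑ˡ m) (n ↑ʳ v)
        ≡⟨ cong₂ _+_ (sum-cong-≗ inner) (sum-cong-≗ cross) ⟩
      ∑[ v < n ] indicator (isEdge G u v) + ∑[ v < m ] 0
        ≡⟨ cong (_ +_) (sum-replicate-zero m) ⟩
      ∑[ v < n ] indicator (isEdge G u v) + 0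
        ≡⟨ +-identityʳ _ ⟩
      ∑[ v < n ] indicator (isEdge G u v)
        ∎
      where
      inner : ∀ v → edge (u ↑ˡ m) (v ↑ˡ m) ≡ indicator (isEdge G u v)
      inner v = cong indicator (cong₂ _∧_ (cong₂ _<ᵇ_ (toℕ-↑ˡ u m) (toℕ-↑ˡ v m)) (⊕-adj-↑ˡ↑ˡ u v))
      cross : ∀ v → edge (u ↑ˡ m) (n ↑ʳ v) ≡ 0
      cross v = cong indicator (trans (cong (_ ∧_) (⊕-adj-↑ˡ↑ʳ u v)) (∧-zeroʳ _))

    edgeCountʳ : ∀ u → ∑[ j < n + m ] edge (n ↑ʳ u) j ≡ ∑[ v < m ] indicator (isEdge H u v)
    edgeCountʳ u = begin
      ∑[ j < n + m ] edge (n ↑ʳ u) j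
        ≡⟨ sum-↑ n _ ⟩
      ∑[ v < n ] edge (n ↑ʳ u) (v ↑ˡ m) + ∑[ v < m ] edge (n ↑ʳ u) (n ↑ʳ v)
        ≡⟨ cong₂ _+_ (sum-cong-≗ cross) (sum-cong-≗ inner) ⟩
      ∑[ v < n ] 0 + ∑[ v < m ] indicator (isEdge H u v)
        ≡⟨ cong (_+ _) (sum-replicate-zero n) ⟩
      ∑[ v < m ] indicator (isEdge H u v)
        ∎
      where
      inner : ∀ v → edge (n ↑ʳ u) (n ↑ʳ v) ≡ indicator (isEdge H u v)
      inner v = cong indicator (cong₂ _∧_
        (trans (cong₂ _<ᵇ_ (toℕ-↑ʳ n u) (toℕ-↑ʳ n v)) (<ᵇ-cancelˡ-+ n _ _)) (⊕-adj-↑ʳ↑ʳ u v))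
      cross : ∀ v → edge (n ↑ʳ u) (v ↑ˡ m) ≡ 0
      cross v = cong indicator (trans (cong (_ ∧_) (⊕-adj-↑ʳ↑ˡ u v)) (∧-zeroʳ _))

  edgeCount-⊕ : edgeCount _⊕_ ≡ edgeCount G + edgeCount H
  edgeCount-⊕ = begin
    edgeCount _⊕_
      ≡⟨ edgeCount-sum _⊕_ ⟩
    ∑[ i < n + m ] ∑[ j < n + m ] edge i j
      ≡⟨ sum-↑ n _ ⟩
    ∑[ u < n ] ∑[ j < n + m ] edge (u ↑ˡ m) j + ∑[ u < m ] ∑[ j < n + m ] edge (n ↑ʳ u) j
      ≡⟨ cong₂ _+_ (sum-cong-≗ edgeCountˡ) (sum-cong-≗ edgeCountʳ) ⟩
    ∑[ u < n ] ∑[ v < n ] indicator (isEdge G u v) + ∑[ u < m ] ∑[ v < m ] indicator (isEdge H u v)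
      ≡⟨ cong₂ _+_ (edgeCount-sum G) (edgeCount-sum H) ⟨
    edgeCount G + edgeCount H
      ∎

  Is3PVC-⊕ˡ : ∀ p q → Is3PVC _⊕_ (p ++ q) → Is3PVC G p
  Is3PVC-⊕ˡ p q covers u v w u≢w uv vw =
    Sum.map (x↑ˡ∈p++q⇒x∈p p) (Sum.map (x↑ˡ∈p++q⇒x∈p p) (x↑ˡ∈p++q⇒x∈p p))
      (covers (u ↑ˡ m) (v ↑ˡ m) (w ↑ˡ m) (u≢w ∘ ↑ˡ-injective m u w)
        (trans (⊕-adj-↑ˡ↑ˡ u v) uv) (trans (⊕-adj-↑ˡ↑ˡ v w) vw))

  Is3PVC-⊕ʳ : ∀ p q → Is3PVC _⊕_ (p ++ q) → Is3PVC H q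
  Is3PVC-⊕ʳ p q covers u v w u≢w uv vw =
    Sum.map (n↑ʳx∈p++q⇒x∈q p) (Sum.map (n↑ʳx∈p++q⇒x∈q p) (n↑ʳx∈p++q⇒x∈q p))
      (covers (n ↑ʳ u) (n ↑ʳ v) (n ↑ʳ w) (u≢w ∘ ↑ʳ-injective n u w)
        (trans (⊕-adj-↑ʳ↑ʳ u v) uv) (trans (⊕-adj-↑ʳ↑ʳ v w) vw))

  ≤ψ₃-⊕ : ∀ {k l} → k ≤ψ₃ G → l ≤ψ₃ H → k + l ≤ψ₃ _⊕_
  ≤ψ₃-⊕ {k} {l} k≤ψ₃G l≤ψ₃H S covers with p , q , refl ← Vec.splitAt n S =
    subst (k + l ≤_) (≡.sym (∣p++q∣≡∣p∣+∣q∣ p q))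
      (+-mono-≤ (k≤ψ₃G p (Is3PVC-⊕ˡ p q covers)) (l≤ψ₃H q (Is3PVC-⊕ʳ p q covers)))

emptyGraph : Graph 0
emptyGraph = record { adj = λ () ; sym = λ () ; irrefl = λ () }

copies : ∀ {k} (t : ℕ) → Graph k → Graph (t * k)
copies zero    G = emptyGraph
copies (suc t) G = G ⊕ copies t G

edgeCount-copies : ∀ {k} t (G : Graph k) → edgeCount (copies t G) ≡ t * edgeCount G
edgeCount-copies zero    G = refl
edgeCount-copies (suc t) G =
  trans (edgeCount-⊕ G (copies t G)) (cong (edgeCount G +_) (edgeCount-copies t G))

≤ψ₃-copies : ∀ {k c} {G : Graph k} → c ≤ψ₃ G → ∀ t → t * c ≤ψ₃ copies t G
≤ψ₃-copies c≤ψ₃G zero    S _ = z≤n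
≤ψ₃-copies c≤ψ₃G (suc t) = ≤ψ₃-⊕ _ _ c≤ψ₃G (≤ψ₃-copies c≤ψ₃G t)

∉-embedding : ∀ {n} k (p : Subset n) → k + ∣ p ∣ ≤ n →
  Σ[ ι ∈ (Fin k → Fin n) ] Injective _≡_ _≡_ ι × (∀ i → ι i ∉ p)
∉-embedding         zero    p            _  = (λ ()) , (λ { {()} }) , (λ ())
∉-embedding         (suc k) []           ()
∉-embedding {suc n} k       (inside ∷ p) k+∣p∣≤n
  with ι , ι-injective , ι∉p ← ∉-embedding k p (s≤s⁻¹ (subst (_≤ suc n) (+-suc k ∣ p ∣) k+∣p∣≤n)) =
  suc ∘ ι , ι-injective ∘ suc-injective , λ { i (there e) → ι∉p i e }
∉-embedding {suc n} (suc k) (outside ∷ p) k+∣p∣≤n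
  with ι , ι-injective , ι∉p ← ∉-embedding k p (s≤s⁻¹ k+∣p∣≤n) = ι′ , ι′-injective , ι′∉p
  where
  ι′ : Fin (suc k) → Fin (suc n)
  ι′ zero    = zero
  ι′ (suc i) = suc (ι i)
  ι′-injective : Injective _≡_ _≡_ ι′
  ι′-injective {zero}  {zero}  _ = refl
  ι′-injective {suc i} {suc j} e = cong suc (ι-injective (suc-injective e))
  ι′∉p : ∀ i → ι′ i ∉ outside ∷ p
  ι′∉p zero    ()
  ι′∉p (suc i) (there e) = ι∉p i e

MeetsEveryTriple : ∀ {n} → Subset n → Set
MeetsEveryTriple {n} p = ∀ (u v w : Fin n) → u ≢ v → v ≢ w → u ≢ w → u ∈ p ⊎ v ∈ p ⊎ w ∈ p

meetsEveryTriple⇒n≤2+∣p∣ : ∀ {n} (p : Subset n) → MeetsEveryTriple p → n ≤ 2 + ∣ p ∣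
meetsEveryTriple⇒n≤2+∣p∣ {n} p meets with n ≤? 2 + ∣ p ∣
... | yes n≤2+∣p∣ = n≤2+∣p∣
... | no  n≰2+∣p∣ with ι , ι-injective , ι∉p ← ∉-embedding 3 p (≰⇒> n≰2+∣p∣) =
  contradiction (meets (ι zero) (ι (suc zero)) (ι (suc (suc zero)))
                       ((λ ()) ∘ ι-injective) ((λ ()) ∘ ι-injective) ((λ ()) ∘ ι-injective))
                [ ι∉p _ , [ ι∉p _ , ι∉p _ ]′ ]′

AtMostTwoToOne : ∀ {n k} → (Fin n → Fin k) → Set
AtMostTwoToOne f = ∀ {u v w} → f u ≡ f v → f v ≡ f w → u ≡ v ⊎ v ≡ w ⊎ u ≡ w

module _ {n k : ℕ} (colour : Fin n → Fin k) where

  completeMultipartite : Graph n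
  completeMultipartite = record
    { adj    = λ u v → not (does (colour u ≟ colour v))
    ; sym    = λ u v → cong not (does-⇔ (mk⇔ ≡.sym ≡.sym) (colour u ≟ colour v) (colour v ≟ colour u))
    ; irrefl = λ u → cong not (dec-true (colour u ≟ colour u) refl)
    }

  adj-completeMultipartite : ∀ {u v} → colour u ≢ colour v → adj completeMultipartite u v ≡ true
  adj-completeMultipartite {u} {v} cu≢cv = cong not (dec-false (colour u ≟ colour v) cu≢cv)

  Is3PVC⇒meetsEveryTriple : AtMostTwoToOne colour →
    ∀ {S} → Is3PVC completeMultipartite S → MeetsEveryTriple S
  Is3PVC⇒meetsEveryTriple twoToOne covers u v w u≢v v≢w u≢w
    with colour u ≟ colour w | colour v ≟ colour u
  ... | yes cu≡cw | _ =
    covers u v w u≢w (adj-completeMultipartite cu≢cv) (adj-completeMultipartite cv≢cw)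
    where
    cu≢cv : colour u ≢ colour v
    cu≢cv cu≡cv = [ u≢v , [ v≢w , u≢w ]′ ]′ (twoToOne cu≡cv (trans (≡.sym cu≡cv) cu≡cw))
    cv≢cw : colour v ≢ colour w
    cv≢cw cv≡cw = cu≢cv (trans cu≡cw (≡.sym cv≡cw))
  ... | no cu≢cw | no cv≢cu =
    [ inj₂ ∘ inj₁ , map₂ inj₂ ]′
      (covers v u w v≢w (adj-completeMultipartite cv≢cu) (adj-completeMultipartite cu≢cw))
  ... | no cu≢cw | yes cv≡cu =
    map₂ swap (covers u w v u≢v (adj-completeMultipartite cu≢cw) (adj-completeMultipartite cw≢cv))
    where
    cw≢cv : colour w ≢ colour v
    cw≢cv cw≡cv = cu≢cw (≡.sym (trans cw≡cv cv≡cu))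

fin2-pigeonhole : ∀ (x y z : Fin 2) → x ≡ y ⊎ y ≡ z ⊎ x ≡ z
fin2-pigeonhole zero       zero       _          = inj₁ refl
fin2-pigeonhole (suc zero) (suc zero) _          = inj₁ refl
fin2-pigeonhole zero       (suc zero) zero       = inj₂ (inj₂ refl)
fin2-pigeonhole zero       (suc zero) (suc zero) = inj₂ (inj₁ refl)
fin2-pigeonhole (suc zero) zero       zero       = inj₂ (inj₁ refl)
fin2-pigeonhole (suc zero) zero       (suc zero) = inj₂ (inj₂ refl)

quotient-remainder-injective : ∀ m n {i j : Fin (m * n)} →
  quotient {m} n i ≡ quotient {m} n j → remainder {m} n i ≡ remainder {m} n j → i ≡ j
quotient-remainder-injective m n {i} {j} qi≡qj ri≡rj = begin
  i                                              ≡⟨ combine-remQuot {m} n i ⟨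
  combine (quotient {m} n i) (remainder {m} n i) ≡⟨ cong₂ combine qi≡qj ri≡rj ⟩
  combine (quotient {m} n j) (remainder {m} n j) ≡⟨ combine-remQuot {m} n j ⟩
  j                                              ∎

quotient-atMostTwoToOne : ∀ m → AtMostTwoToOne (quotient {m} 2)
quotient-atMostTwoToOne m {u} {v} {w} qu≡qv qv≡qw =
  Sum.map (quotient-remainder-injective m 2 qu≡qv)
    (Sum.map (quotient-remainder-injective m 2 qv≡qw)
             (quotient-remainder-injective m 2 (trans qu≡qv qv≡qw)))
    (fin2-pigeonhole (remainder {m} 2 u) (remainder {m} 2 v) (remainder {m} 2 w))

cocktailParty : ∀ m → Graph (m * 2)
cocktailParty m = completeMultipartite (quotient {m} 2)

≤ψ₃-cocktailParty : ∀ m → m * 2 ≤ψ₃ cocktailParty (suc m)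
≤ψ₃-cocktailParty m S covers = +-cancelˡ-≤ 2 _ _
  (meetsEveryTriple⇒n≤2+∣p∣ S
    (Is3PVC⇒meetsEveryTriple (quotient 2) (quotient-atMostTwoToOne (suc m)) covers))

C₄ : Graph 4
C₄ = cocktailParty 2

octahedron : Graph 6
octahedron = cocktailParty 3

extremalGraph : (c d : ℕ) → Graph (3 * c * 4 + 2 * d * 6)
extremalGraph c d = copies (3 * c) C₄ ⊕ copies (2 * d) octahedron

edgeCount-extremalGraph : ∀ c d → edgeCount (extremalGraph c d) ≡ 3 * c * 4 + 2 * d * 12
edgeCount-extremalGraph c d =
  trans (edgeCount-⊕ (copies (3 * c) C₄) (copies (2 * d) octahedron))
        (cong₂ _+_ (edgeCount-copies (3 * c) C₄) (edgeCount-copies (2 * d) octahedron))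

≤ψ₃-extremalGraph : ∀ c d → 3 * c * 2 + 2 * d * 4 ≤ψ₃ extremalGraph c d
≤ψ₃-extremalGraph c d =
  ≤ψ₃-⊕ _ _ (≤ψ₃-copies (≤ψ₃-cocktailParty 1) (3 * c)) (≤ψ₃-copies (≤ψ₃-cocktailParty 2) (2 * d))

b≤a≤2b⇒decomposition : ∀ {a b} → b ≤ a → a ≤ 2 * b → ∃₂ λ c d → b ≡ c + d × a ≡ c + d + d
b≤a≤2b⇒decomposition {a} {b} b≤a a≤2b = b ∸ d , d , ≡.sym (m∸n+n≡m d≤b) , a≡c+d+d
  where
  d : ℕ
  d = a ∸ b
  d≤b : d ≤ b
  d≤b = ≤-trans (m≤n+o⇒m∸n≤o a b a≤2b) (≤-reflexive (+-identityʳ b))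
  a≡c+d+d : a ≡ b ∸ d + d + d
  a≡c+d+d = begin
    a             ≡⟨ m+[n∸m]≡n b≤a ⟨
    b + d         ≡⟨ cong (_+ d) (m∸n+n≡m d≤b) ⟨
    b ∸ d + d + d ∎

theorem8 : (a b : ℕ) → 1 ≤ b → b ≤ a → a ≤ 2 * b →
    Σ ℕ (λ n → Σ (Graph n) (λ G →
      (1 ≤ n) × (edgeCount G * b ≡ a * n) × ψ₃≥ G (2 * n + edgeCount G) 6))
theorem8 a b 1≤b b≤a a≤2b with c , d , refl , refl ← b≤a≤2b⇒decomposition b≤a a≤2b =
  n , extremalGraph c d , 1≤n , edges ,
  ≤ψ₃⇒ψ₃≥ {G = extremalGraph c d} 6 (≤-reflexive 2n+m≡6ψ) (≤ψ₃-extremalGraph c d)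
  where
  n : ℕ
  n = 3 * c * 4 + 2 * d * 6
  m≡ : edgeCount (extremalGraph c d) ≡ 3 * c * 4 + 2 * d * 12
  m≡ = edgeCount-extremalGraph c d
  n≡12[c+d] : ∀ x y → 12 * (x + y) ≡ 3 * x * 4 + 2 * y * 6
  n≡12[c+d] = solve-∀
  m*b≡a*n : ∀ x y → (3 * x * 4 + 2 * y * 12) * (x + y) ≡ (x + y + y) * (3 * x * 4 + 2 * y * 6)
  m*b≡a*n = solve-∀
  2n+m≡6[6c+8d] : ∀ x y →
    2 * (3 * x * 4 + 2 * y * 6) + (3 * x * 4 + 2 * y * 12) ≡ 6 * (3 * x * 2 + 2 * y * 4)
  2n+m≡6[6c+8d] = solve-∀
  1≤n : 1 ≤ n
  1≤n = ≤-trans 1≤b (subst (c + d ≤_) (n≡12[c+d] c d) (m≤n*m (c + d) 12))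
  edges : edgeCount (extremalGraph c d) * (c + d) ≡ (c + d + d) * n
  edges = trans (cong (_* (c + d)) m≡) (m*b≡a*n c d)
  2n+m≡6ψ : 2 * n + edgeCount (extremalGraph c d) ≡ 6 * (3 * c * 2 + 2 * d * 4)
  2n+m≡6ψ = trans (cong (2 * n +_) m≡) (2n+m≡6[6c+8d] c d)
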